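{- Let $\mathcal{D}_4$ be the set of partitions in which each part size appears fewer than $4$ times, and for $\lambda\in\mathcal{D}_4$ let $e(\lambda)$ be the number of part sizes of $\lambda$ that appear exactly $2$ or $3$ times. Let $\overline{\mathcal{P}}$ be the set of overpartitions and for $\mu\in\overline{\mathcal{P}}$ let $o(\mu)$ be the number of overlined parts of $\mu$, $\ell(\mu)$ its number of parts and $|\mu|$ its size. Then, as formal power series, \[ \sum_{\lambda \in \mathcal{D}_4} t_1^{e(\lambda)}\, t_2^{\lambda_1 - \lambda_2 + \lambda_3-\lambda_4 + \cdots}\, q^{\lambda_1 + \lambda_3 + \lambda_5 + \cdots} = \sum_{\mu \in \overline{\mathcal{P}}} t_1^{o(\mu)}\, t_2^{\ell(\mu)-o(\mu)}\, q^{|\mu|}. \]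
   Context: A partition $\lambda$ is a weakly decreasing sequence $(\lambda_1,\dots,\lambda_\ell)$ of positive integers with $\lambda_k=0$ for $k>\ell$. An overpartition is a partition in which the first occurrence of any part size may (optionally) be distinguished with an overline. -}

module Defs where

open import Data.Nat using (ℕ; zero; suc; _+_; _∸_; _≤_; _<_; _≟_)
open import Data.Bool using (Bool; true; false)
open import Data.List using (List; []; _∷_; length; filter; deduplicate; map)
open import Data.Nat.ListAction using (sum)
open import Data.List.Relation.Unary.All using (All)
open import Data.List.Relation.Unary.Linked using (Linked)
open import Data.Product using (Σ; _×_; _,_; proj₁)
open import Relation.Binary.PropositionalEquality using (_≡_)
open import Relation.Nullary using (Dec; yes; no)
open import Data.Sum using (_⊎_)

IsPartition : List ℕ → Set
IsPartition λs = Linked (λ x y → y ≤ x) λs × All (λ x → 0 < x) λs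

mult : ℕ → List ℕ → ℕ
mult x λs = length (filter (x ≟_) λs)

InD4 : List ℕ → Set
InD4 λs = IsPartition λs × All (λ x → mult x λs < 4) λs

twoOrThree? : (m : ℕ) → Dec (m ≡ 2 ⊎ m ≡ 3)
twoOrThree? m with m ≟ 2 | m ≟ 3
... | yes p | _ = yes (_⊎_.inj₁ p)
... | no _  | yes q = yes (_⊎_.inj₂ q)
... | no p  | no q = no λ { (_⊎_.inj₁ r) → p r ; (_⊎_.inj₂ r) → q r }

e : List ℕ → ℕ
e λs = length (filter (λ x → twoOrThree? (mult x λs)) (deduplicate _≟_ λs))

-- λ₁ - λ₂ + λ₃ - λ₄ + ⋯  (each λ_{2k-1} ∸ λ_{2k} is a genuine difference
-- since λ is weakly decreasing)
altSum : List ℕ → ℕ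
altSum [] = 0
altSum (x ∷ []) = x
altSum (x ∷ y ∷ r) = (x ∸ y) + altSum r

oddSum : List ℕ → ℕ
oddSum [] = 0
oddSum (x ∷ []) = x
oddSum (x ∷ y ∷ r) = x + oddSum r

-- Canonical form: among equal parts, the overlined one
-- (if any) is listed first; so an entry can be overlined only if the part
-- before it is strictly larger (i.e. it is the first occurrence).

OvStep : ℕ × Bool → ℕ × Bool → Set
OvStep (x , _) (y , true)  = y < x
OvStep (x , _) (y , false) = y ≤ x

IsOverpartition : List (ℕ × Bool) → Set
IsOverpartition μ = Linked OvStep μ × All (λ p → 0 < proj₁ p) μ

overlined : List (ℕ × Bool) → ℕ
overlined [] = 0
overlined ((_ , true) ∷ r) = suc (overlined r)
overlined ((_ , false) ∷ r) = overlined r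

size : List (ℕ × Bool) → ℕ
size μ = sum (map proj₁ μ)

-- Coefficient sets.
-- D4Coeff n a b : partitions λ ∈ 𝒟₄ contributing t₁^a t₂^b q^n to the LHS.
D4Coeff : ℕ → ℕ → ℕ → Set
D4Coeff n a b = Σ (List ℕ) λ λs →
  InD4 λs × e λs ≡ a × altSum λs ≡ b × oddSum λs ≡ n

-- OPCoeff n a b : overpartitions μ contributing t₁^a t₂^b q^n to the RHS.
OPCoeff : ℕ → ℕ → ℕ → Set
OPCoeff n a b = Σ (List (ℕ × Bool)) λ μ →
  IsOverpartition μ × overlined μ ≡ a × length μ ∸ overlined μ ≡ b × size μ ≡ n

-- Write λ ∈ 𝒟₄ as two copies of a strict partition A merged with a strict partition B: a part size
-- occurring m times lies in A iff m ≥ 2 and in B iff m is odd.  Then e(λ) = ℓ(A), and since the two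
-- adjacent copies of a part of A fall once on an odd and once on an even position,
-- λ₁ + λ₃ + ⋯ = |A| + (B₁ + B₃ + ⋯) and λ₁ − λ₂ + λ₃ − ⋯ = B₁ − B₂ + B₃ − ⋯.
-- Next, strict partitions B correspond to partitions ν with Frobenius coordinates (α₁ … αₛ | β₁ … βₛ)
-- via B₂ᵢ₋₁ = αᵢ + βᵢ + 1 and B₂ᵢ = αᵢ + βᵢ₊₁ + 1, where βₛ₊₁ = −1 and a resulting zero is dropped.
-- The sum B₁ − B₂ + B₃ − ⋯ telescopes to β₁ + 1 = ℓ(ν), and B₁ + B₃ + ⋯ = |ν|.  Each pair B₂ᵢ₋₁, B₂ᵢ
-- is one hook (first row and first column) of ν, so ν is built and taken apart hook by hook.
-- Finally (A, ν) is the overpartition with overlined parts A and plain parts ν.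

{-# OPTIONS --safe #-}

module Submission where

open import Defs
open import Data.Nat using (ℕ; zero; suc; _+_; _∸_; _≤_; _<_; _≥_; _>_; _≟_; _<ᵇ_; _≤ᵇ_; s≤s; z≤n)
open import Data.Nat.Properties
open import Algebra.Properties.CommutativeSemigroup +-commutativeSemigroup
  using (x∙yz≈y∙xz; xy∙z≈xz∙y; interchange)
open import Data.Bool using (Bool; true; false; if_then_else_)
open import Data.Unit using (tt)
open import Data.List using (List; []; _∷_; length; map; replicate; _++_; filter; deduplicate)
open import Data.List.Properties
  using (length-++; length-map; length-replicate; filter-accept; filter-reject; filter-idem; filter-all;
         map-cong-local)
open import Data.Nat.ListAction using (sum)
open import Data.Nat.ListAction.Properties using (sum-++)
open import Data.List.Relation.Unary.All as All using (All; []; _∷_)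
open import Data.List.Relation.Unary.All.Properties as All using (replicate⁺; ++⁺)
open import Data.List.Relation.Unary.AllPairs as AllPairs using (AllPairs; []; _∷_)
open import Data.List.Relation.Unary.AllPairs.Properties as AllPairs using ()
open import Data.List.Relation.Unary.Linked as Linked using (Linked)
open import Data.List.Relation.Unary.Linked.Properties using (AllPairs⇒Linked; Linked⇒AllPairs)
open import Data.Product as Product using (Σ; ∃; ∃₂; _×_; _,_; -,_; proj₁; proj₂)
open import Data.Sum using (_⊎_; inj₁; inj₂)
open import Function.Base using (id; flip; _∘_)
open import Function.Bundles using (_↔_; mk↔ₛ′)
open import Function.Properties.Inverse using (↔-trans)
open import Relation.Binary.Definitions using (Transitive)
open import Relation.Binary.PropositionalEquality
open import Relation.Nullary using (Dec; yes; no; does; contradiction; Irrelevant)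
open import Relation.Nullary.Decidable using (¬?)
open import Relation.Nullary.Reflects using (ofʸ; ofⁿ)
open import Relation.Unary using (Decidable)

module _ {X Y : Set} {P : X → Set} {Q : Y → Set}
         (P-irrelevant : ∀ {x} → Irrelevant (P x)) (Q-irrelevant : ∀ {y} → Irrelevant (Q y)) where

  restrict-↔ : (f : X → Y) (g : Y → X) →
               (∀ {x} → P x → Q (f x)) → (∀ {y} → Q y → P (g y)) →
               (∀ {x} → P x → g (f x) ≡ x) → (∀ {y} → Q y → f (g y) ≡ y) →
               Σ X P ↔ Σ Y Q
  restrict-↔ f g f-resp g-resp g∘f f∘g = mk↔ₛ′
    (λ (x , p) → f x , f-resp p) (λ (y , q) → g y , g-resp q)
    (λ (y , q) → Σ-≡ Q-irrelevant (f∘g q))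
    (λ (x , p) → Σ-≡ P-irrelevant (g∘f p))
    where
    Σ-≡ : ∀ {Z : Set} {R : Z → Set} → (∀ {z} → Irrelevant (R z)) →
          ∀ {z z′} {r : R z} {r′ : R z′} → z ≡ z′ → (z , r) ≡ (z′ , r′)
    Σ-≡ irr {r = r} {r′} refl = cong (_ ,_) (irr r r′)

×-irrelevant : {A B : Set} → Irrelevant A → Irrelevant B → Irrelevant (A × B)
×-irrelevant irrA irrB (a , b) (a′ , b′) = cong₂ _,_ (irrA a a′) (irrB b b′)

×-≡-irrelevant : ∀ {A : Set} {m n k m′ n′ k′ : ℕ} → Irrelevant A →
                 Irrelevant (A × m ≡ m′ × n ≡ n′ × k ≡ k′)
×-≡-irrelevant irr = ×-irrelevant irr (×-irrelevant ≡-irrelevant (×-irrelevant ≡-irrelevant ≡-irrelevant))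

IsStrictPartition : List ℕ → Set
IsStrictPartition A = AllPairs _>_ A × All (0 <_) A

strict⇒sorted : ∀ {l} → AllPairs _>_ l → AllPairs _≥_ l
strict⇒sorted = AllPairs.map <⇒≤

partition-sorted : ∀ {ν} → IsPartition ν → AllPairs _≥_ ν
partition-sorted = Linked⇒AllPairs (flip ≤-trans) ∘ proj₁

partition-irrelevant : ∀ {ν} → Irrelevant (IsPartition ν)
partition-irrelevant = ×-irrelevant (Linked.irrelevant ≤-irrelevant) (All.irrelevant ≤-irrelevant)

strictPartition-irrelevant : ∀ {A} → Irrelevant (IsStrictPartition A)
strictPartition-irrelevant =
  ×-irrelevant (AllPairs.irrelevant ≤-irrelevant) (All.irrelevant ≤-irrelevant)

-- 𝒟₄ and pairs of strict partitions
mult-∷-self : ∀ x λs → mult x (x ∷ λs) ≡ suc (mult x λs)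
mult-∷-self x λs = cong length (filter-accept (x ≟_) refl)

mult-∷-other : ∀ {x y} λs → y ≢ x → mult y (x ∷ λs) ≡ mult y λs
mult-∷-other {y = y} λs y≢x = cong length (filter-reject (y ≟_) y≢x)

mult-∷-≤ : ∀ x y λs → mult y λs ≤ mult y (x ∷ λs)
mult-∷-≤ x y λs with y ≟ x
... | yes y≡x = ≤-trans (n≤1+n _) (≤-reflexive (sym (cong length (filter-accept (y ≟_) y≡x))))
... | no y≢x  = ≤-reflexive (sym (mult-∷-other λs y≢x))

mult-absent : ∀ {x λs} → All (_< x) λs → mult x λs ≡ 0
mult-absent [] = refl
mult-absent (y<x ∷ λs<x) = trans (mult-∷-other _ (>⇒≢ y<x)) (mult-absent λs<x)

mult-run : ∀ {x λs} m → All (_< x) λs → mult x (replicate m x ++ λs) ≡ m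
mult-run zero λs<x = mult-absent λs<x
mult-run {x} (suc m) λs<x = trans (mult-∷-self x _) (cong suc (mult-run m λs<x))

mult-run-below : ∀ {x y λs} m → y < x → mult y (replicate m x ++ λs) ≡ mult y λs
mult-run-below zero _ = refl
mult-run-below (suc m) y<x = trans (mult-∷-other _ (<⇒≢ y<x)) (mult-run-below m y<x)

mult<-run : ∀ {k x λs} m → m < k → All (_< x) λs → All (λ y → mult y λs < k) λs →
            All (λ y → mult y (replicate m x ++ λs) < k) (replicate m x ++ λs)
mult<-run {k} m m<k λs<x bounded =
  ++⁺ (replicate⁺ m (subst (_< k) (sym (mult-run m λs<x)) m<k))
      (All.zipWith (λ (y<x , y-bounded) → subst (_< k) (sym (mult-run-below m y<x)) y-bounded)
                   (λs<x , bounded))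

All-deduplicate : ∀ {A : Set} {R : A → A → Set} (R? : ∀ x y → Dec (R x y)) {P : A → Set} {xs} →
                  All P xs → All P (deduplicate R? xs)
All-deduplicate R? [] = []
All-deduplicate R? {xs = x ∷ _} (p ∷ ps) = p ∷ All.filter⁺ (¬? ∘ R? x) (All-deduplicate R? ps)

deduplicate-fresh : ∀ {x λs} → All (_< x) λs → deduplicate _≟_ (x ∷ λs) ≡ x ∷ deduplicate _≟_ λs
deduplicate-fresh {x} λs<x = cong (x ∷_) (filter-all (¬? ∘ (x ≟_)) (All-deduplicate _≟_ (All.map >⇒≢ λs<x)))

deduplicate-repeat : ∀ x λs → deduplicate _≟_ (x ∷ x ∷ λs) ≡ deduplicate _≟_ (x ∷ λs)
deduplicate-repeat x λs = cong (x ∷_) (trans (filter-reject x≢? (λ x≢x → x≢x refl))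
                                               (filter-idem x≢? (deduplicate _≟_ λs)))
  where x≢? = ¬? ∘ (x ≟_)

deduplicate-run : ∀ {x λs} m → All (_< x) λs →
                  deduplicate _≟_ (replicate (suc m) x ++ λs) ≡ x ∷ deduplicate _≟_ λs
deduplicate-run zero λs<x = deduplicate-fresh λs<x
deduplicate-run {x} {λs} (suc m) λs<x =
  trans (deduplicate-repeat x (replicate m x ++ λs)) (deduplicate-run m λs<x)

multiplicities : List ℕ → List ℕ
multiplicities λs = map (λ y → mult y λs) (deduplicate _≟_ λs)

multiplicities-run : ∀ {x λs} m → All (_< x) λs →
                     multiplicities (replicate (suc m) x ++ λs) ≡ suc m ∷ multiplicities λs
multiplicities-run {x} {λs} m λs<x = begin
  map (λ y → mult y L) (deduplicate _≟_ L)
    ≡⟨ cong (map (λ y → mult y L)) (deduplicate-run m λs<x) ⟩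
  mult x L ∷ map (λ y → mult y L) (deduplicate _≟_ λs)
    ≡⟨ cong₂ _∷_ (mult-run (suc m) λs<x) (map-cong-local below) ⟩
  suc m ∷ multiplicities λs
    ∎
  where
  open ≡-Reasoning
  L = replicate (suc m) x ++ λs
  below = All.map (mult-run-below (suc m)) (All-deduplicate _≟_ λs<x)

length-filter-map : ∀ {A B : Set} {P : B → Set} (P? : Decidable P) (f : A → B) xs →
                    length (filter (P? ∘ f) xs) ≡ length (filter P? (map f xs))
length-filter-map P? f [] = refl
length-filter-map P? f (x ∷ xs) with does (P? (f x))
... | true  = cong suc (length-filter-map P? f xs)
... | false = length-filter-map P? f xs

e-multiplicities : ∀ λs → e λs ≡ length (filter twoOrThree? (multiplicities λs))
e-multiplicities λs = length-filter-map twoOrThree? (λ y → mult y λs) (deduplicate _≟_ λs)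

e-run : ∀ {x λs} m → All (_< x) λs →
        e (replicate (suc m) x ++ λs) ≡ length (filter twoOrThree? (suc m ∷ multiplicities λs))
e-run {x} {λs} m λs<x = trans (e-multiplicities (replicate (suc m) x ++ λs))
                              (cong (length ∘ filter twoOrThree?) (multiplicities-run m λs<x))

evenSum : List ℕ → ℕ
evenSum [] = 0
evenSum (_ ∷ λs) = oddSum λs

oddSum-∷ : ∀ x λs → oddSum (x ∷ λs) ≡ x + evenSum λs
oddSum-∷ x [] = sym (+-identityʳ x)
oddSum-∷ x (_ ∷ _) = refl

altSum+evenSum : ∀ {λs} → AllPairs _≥_ λs → altSum λs + evenSum λs ≡ oddSum λs
altSum+evenSum {[]} _ = refl
altSum+evenSum {x ∷ []} _ = +-identityʳ x
altSum+evenSum {x ∷ y ∷ λs} ((y≤x ∷ _) ∷ (_ ∷ sorted)) = begin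
  (x ∸ y) + altSum λs + oddSum (y ∷ λs)     ≡⟨ cong ((x ∸ y) + altSum λs +_) (oddSum-∷ y λs) ⟩
  (x ∸ y) + altSum λs + (y + evenSum λs)    ≡⟨ interchange (x ∸ y) (altSum λs) y (evenSum λs) ⟩
  (x ∸ y) + y + (altSum λs + evenSum λs)    ≡⟨ cong₂ _+_ (m∸n+n≡m y≤x) (altSum+evenSum sorted) ⟩
  x + oddSum λs                             ∎
  where open ≡-Reasoning

data Merge : List ℕ → List ℕ → List ℕ → Set where
  []     : Merge [] [] []
  once   : ∀ {x A B λs} → All (_< x) λs → Merge A B λs → Merge A (x ∷ B) (x ∷ λs)
  twice  : ∀ {x A B λs} → All (_< x) λs → Merge A B λs → Merge (x ∷ A) B (x ∷ x ∷ λs)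
  thrice : ∀ {x A B λs} → All (_< x) λs → Merge A B λs → Merge (x ∷ A) (x ∷ B) (x ∷ x ∷ x ∷ λs)

module _ {P : ℕ → Set} where

  Merge-All⁺ : ∀ {A B λs} → Merge A B λs → All P A → All P B → All P λs
  Merge-All⁺ [] [] [] = []
  Merge-All⁺ (once _ M) pA (p ∷ pB) = p ∷ Merge-All⁺ M pA pB
  Merge-All⁺ (twice _ M) (p ∷ pA) pB = p ∷ p ∷ Merge-All⁺ M pA pB
  Merge-All⁺ (thrice _ M) (p ∷ pA) (_ ∷ pB) = p ∷ p ∷ p ∷ Merge-All⁺ M pA pB

  Merge-All⁻ : ∀ {A B λs} → Merge A B λs → All P λs → All P A × All P B
  Merge-All⁻ [] [] = [] , []
  Merge-All⁻ (once _ M) (p ∷ ps) = Product.map₂ (p ∷_) (Merge-All⁻ M ps)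
  Merge-All⁻ (twice _ M) (p ∷ _ ∷ ps) = Product.map₁ (p ∷_) (Merge-All⁻ M ps)
  Merge-All⁻ (thrice _ M) (p ∷ _ ∷ _ ∷ ps) = Product.map (p ∷_) (p ∷_) (Merge-All⁻ M ps)

Merge⇒sorted : ∀ {A B λs} → Merge A B λs → AllPairs _≥_ λs
Merge⇒sorted [] = []
Merge⇒sorted (once λs<x M) = All.map <⇒≤ λs<x ∷ Merge⇒sorted M
Merge⇒sorted (twice λs<x M) = (≤-refl ∷ All.map <⇒≤ λs<x) ∷ All.map <⇒≤ λs<x ∷ Merge⇒sorted M
Merge⇒sorted (thrice λs<x M) =
  (≤-refl ∷ ≤-refl ∷ All.map <⇒≤ λs<x) ∷ (≤-refl ∷ All.map <⇒≤ λs<x) ∷ All.map <⇒≤ λs<x ∷ Merge⇒sorted M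

Merge⇒strict : ∀ {A B λs} → Merge A B λs → AllPairs _>_ A × AllPairs _>_ B
Merge⇒strict [] = [] , []
Merge⇒strict (once λs<x M) = Product.map₂ (proj₂ (Merge-All⁻ M λs<x) ∷_) (Merge⇒strict M)
Merge⇒strict (twice λs<x M) = Product.map₁ (proj₁ (Merge-All⁻ M λs<x) ∷_) (Merge⇒strict M)
Merge⇒strict (thrice λs<x M) =
  Product.map (proj₁ (Merge-All⁻ M λs<x) ∷_) (proj₂ (Merge-All⁻ M λs<x) ∷_) (Merge⇒strict M)

Merge⇒mult<4 : ∀ {A B λs} → Merge A B λs → All (λ y → mult y λs < 4) λs
Merge⇒mult<4 [] = []
Merge⇒mult<4 (once λs<x M) = mult<-run 1 (<ᵇ⇒< 1 4 tt) λs<x (Merge⇒mult<4 M)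
Merge⇒mult<4 (twice λs<x M) = mult<-run 2 (<ᵇ⇒< 2 4 tt) λs<x (Merge⇒mult<4 M)
Merge⇒mult<4 (thrice λs<x M) = mult<-run 3 (<ᵇ⇒< 3 4 tt) λs<x (Merge⇒mult<4 M)

Merge⇒e : ∀ {A B λs} → Merge A B λs → e λs ≡ length A
Merge⇒e [] = refl
Merge⇒e (once {λs = λs} λs<x M) =
  trans (e-run 0 λs<x) (trans (sym (e-multiplicities λs)) (Merge⇒e M))
Merge⇒e (twice {λs = λs} λs<x M) =
  trans (e-run 1 λs<x) (cong suc (trans (sym (e-multiplicities λs)) (Merge⇒e M)))
Merge⇒e (thrice {λs = λs} λs<x M) =
  trans (e-run 2 λs<x) (cong suc (trans (sym (e-multiplicities λs)) (Merge⇒e M)))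

Merge⇒oddSum : ∀ {A B λs} → Merge A B λs → oddSum λs ≡ sum A + oddSum B
Merge⇒evenSum : ∀ {A B λs} → Merge A B λs → evenSum λs ≡ sum A + evenSum B

Merge⇒oddSum [] = refl
Merge⇒oddSum (once {x} {A} {B} {λs} _ M) = begin
  oddSum (x ∷ λs)              ≡⟨ oddSum-∷ x λs ⟩
  x + evenSum λs               ≡⟨ cong (x +_) (Merge⇒evenSum M) ⟩
  x + (sum A + evenSum B)      ≡⟨ x∙yz≈y∙xz x (sum A) (evenSum B) ⟩
  sum A + (x + evenSum B)      ≡⟨ cong (sum A +_) (oddSum-∷ x B) ⟨
  sum A + oddSum (x ∷ B)       ∎
  where open ≡-Reasoning
Merge⇒oddSum (twice {x} {A} {B} _ M) =
  trans (cong (x +_) (Merge⇒oddSum M)) (sym (+-assoc x (sum A) (oddSum B)))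
Merge⇒oddSum (thrice {x} {A} {B} {λs} _ M) = begin
  x + oddSum (x ∷ λs)              ≡⟨ cong (x +_) (oddSum-∷ x λs) ⟩
  x + (x + evenSum λs)             ≡⟨ cong (λ s → x + (x + s)) (Merge⇒evenSum M) ⟩
  x + (x + (sum A + evenSum B))    ≡⟨ cong (x +_) (x∙yz≈y∙xz x (sum A) (evenSum B)) ⟩
  x + (sum A + (x + evenSum B))    ≡⟨ +-assoc x (sum A) (x + evenSum B) ⟨
  x + sum A + (x + evenSum B)      ≡⟨ cong (x + sum A +_) (oddSum-∷ x B) ⟨
  x + sum A + oddSum (x ∷ B)       ∎
  where open ≡-Reasoning

Merge⇒evenSum [] = refl
Merge⇒evenSum (once _ M) = Merge⇒oddSum M
Merge⇒evenSum (twice {x} {A} {B} {λs} _ M) =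
  trans (oddSum-∷ x λs) (trans (cong (x +_) (Merge⇒evenSum M)) (sym (+-assoc x (sum A) (evenSum B))))
Merge⇒evenSum (thrice {x} {A} {B} _ M) =
  trans (cong (x +_) (Merge⇒oddSum M)) (sym (+-assoc x (sum A) (oddSum B)))

-- The alternating sum is recovered as oddSum − evenSum, which keeps truncated subtraction out of the
-- induction.
Merge⇒altSum : ∀ {A B λs} → Merge A B λs → altSum λs ≡ altSum B
Merge⇒altSum {A} {B} {λs} M = +-cancelʳ-≡ (sum A + evenSum B) (altSum λs) (altSum B) (begin
  altSum λs + (sum A + evenSum B)    ≡⟨ cong (altSum λs +_) (Merge⇒evenSum M) ⟨
  altSum λs + evenSum λs             ≡⟨ altSum+evenSum (Merge⇒sorted M) ⟩
  oddSum λs                          ≡⟨ Merge⇒oddSum M ⟩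
  sum A + oddSum B                   ≡⟨ cong (sum A +_) (altSum+evenSum B-sorted) ⟨
  sum A + (altSum B + evenSum B)     ≡⟨ x∙yz≈y∙xz (sum A) (altSum B) (evenSum B) ⟩
  altSum B + (sum A + evenSum B)     ∎)
  where
  open ≡-Reasoning
  B-sorted = strict⇒sorted (proj₂ (Merge⇒strict M))

below-or-repeated : ∀ {x λs} → AllPairs _≥_ (x ∷ λs) → All (_< x) λs ⊎ ∃ λ λs′ → λs ≡ x ∷ λs′
below-or-repeated {λs = []} _ = inj₁ []
below-or-repeated {x} {y ∷ λs} ((y≤x ∷ _) ∷ (λs≤y ∷ _)) with x ≟ y
... | yes refl = inj₂ (λs , refl)
... | no x≢y   = inj₁ (y<x ∷ All.map (λ z≤y → ≤-<-trans z≤y y<x) λs≤y)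
  where y<x = ≤∧≢⇒< y≤x (x≢y ∘ sym)

Merge-repeat : ∀ {x λs A B} → mult x (x ∷ x ∷ λs) < 4 → Merge A B (x ∷ λs) →
               ∃₂ λ A′ B′ → Merge A′ B′ (x ∷ x ∷ λs)
Merge-repeat _ (once λs<x M) = -, -, twice λs<x M
Merge-repeat _ (twice λs<x M) = -, -, thrice λs<x M
Merge-repeat bounded (thrice λs<x M) = contradiction bounded (<-irrefl (mult-run 4 λs<x))

InD4⇒Merge : ∀ {λs} → AllPairs _≥_ λs → All (λ y → mult y λs < 4) λs → ∃₂ λ A B → Merge A B λs
InD4⇒Merge {[]} [] [] = -, -, []
InD4⇒Merge {x ∷ λs} sorted@(_ ∷ λs-sorted) (x-bounded ∷ λs-bounded)
  with below-or-repeated sorted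
     | InD4⇒Merge λs-sorted (All.map (λ {y} → ≤-<-trans (mult-∷-≤ x y λs)) λs-bounded)
... | inj₁ λs<x       | _ , _ , M = -, -, once λs<x M
... | inj₂ (_ , refl) | _ , _ , M = Merge-repeat x-bounded M

merge : List ℕ → List ℕ → List ℕ
merge [] B = B
merge (a ∷ A) [] = a ∷ a ∷ merge A []
merge aA@(a ∷ A) bB@(b ∷ B) =
  if a <ᵇ b then b ∷ merge aA B
  else if b <ᵇ a then a ∷ a ∷ merge A bB
  else a ∷ a ∷ a ∷ merge A B

merge-once : ∀ {x A B} → All (_< x) A → merge A (x ∷ B) ≡ x ∷ merge A B
merge-once {A = []} [] = refl
merge-once {x} {a ∷ A} (a<x ∷ _) with a <ᵇ x | <ᵇ-reflects-< a x
... | true  | _        = refl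
... | false | ofⁿ a≮x = contradiction a<x a≮x

merge-twice : ∀ {x A B} → All (_< x) B → merge (x ∷ A) B ≡ x ∷ x ∷ merge A B
merge-twice {B = []} [] = refl
merge-twice {x} {B = b ∷ B} (b<x ∷ _) with x <ᵇ b | <ᵇ-reflects-< x b | b <ᵇ x | <ᵇ-reflects-< b x
... | true  | ofʸ x<b | _     | _        = contradiction x<b (<-asym b<x)
... | false | _       | true  | _        = refl
... | false | _       | false | ofⁿ b≮x = contradiction b<x b≮x

merge-thrice : ∀ {x A B} → merge (x ∷ A) (x ∷ B) ≡ x ∷ x ∷ x ∷ merge A B
merge-thrice {x} with x <ᵇ x | <ᵇ-reflects-< x x
... | true  | ofʸ x<x = contradiction x<x (<-irrefl refl)
... | false | _       = refl

Merge⇒merge : ∀ {A B λs} → Merge A B λs → merge A B ≡ λs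
Merge⇒merge [] = refl
Merge⇒merge (once {x} λs<x M) =
  trans (merge-once (proj₁ (Merge-All⁻ M λs<x))) (cong (x ∷_) (Merge⇒merge M))
Merge⇒merge (twice {x} λs<x M) =
  trans (merge-twice (proj₂ (Merge-All⁻ M λs<x))) (cong (λ l → x ∷ x ∷ l) (Merge⇒merge M))
Merge⇒merge (thrice {x} {A} {B} λs<x M) =
  trans (merge-thrice {x} {A} {B}) (cong (λ l → x ∷ x ∷ x ∷ l) (Merge⇒merge M))

merge-Merge : ∀ {A B} → AllPairs _>_ A → AllPairs _>_ B → Merge A B (merge A B)
merge-Merge {[]} {[]} [] [] = []
merge-Merge {[]} {b ∷ B} [] (b>B ∷ B-strict) = once b>B (merge-Merge [] B-strict)
merge-Merge {a ∷ A} {[]} (a>A ∷ A-strict) [] = twice (Merge-All⁺ M a>A []) M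
  where M = merge-Merge A-strict []
merge-Merge {a ∷ A} {b ∷ B} aA@(a>A ∷ A-strict) bB@(b>B ∷ B-strict)
  with a <ᵇ b | <ᵇ-reflects-< a b | b <ᵇ a | <ᵇ-reflects-< b a
     | merge-Merge aA B-strict | merge-Merge A-strict bB | merge-Merge A-strict B-strict
... | true | ofʸ a<b | _ | _ | M | _ | _ =
  once (Merge-All⁺ M (a<b ∷ All.map (λ y<a → <-trans y<a a<b) a>A) b>B) M
... | false | _ | true | ofʸ b<a | _ | M | _ =
  twice (Merge-All⁺ M a>A (b<a ∷ All.map (λ y<b → <-trans y<b b<a) b>B)) M
... | false | ofⁿ a≮b | false | ofⁿ b≮a | _ | _ | M with ≤-antisym (≮⇒≥ b≮a) (≮⇒≥ a≮b)
... | refl = thrice (Merge-All⁺ M a>A b>B) M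

-- Only runs of length 1, 2 or 3 occur in 𝒟₄; the last clause is arbitrary for other lengths.
emit : ℕ → ℕ → List ℕ × List ℕ → List ℕ × List ℕ
emit x 1 (A , B) = A , x ∷ B
emit x 2 (A , B) = x ∷ A , B
emit x _ (A , B) = x ∷ A , x ∷ B

splitRun : ℕ → ℕ → List ℕ → List ℕ × List ℕ
splitRun x m [] = emit x m ([] , [])
splitRun x m (y ∷ λs) with x ≟ y
... | yes _ = splitRun x (suc m) λs
... | no _  = emit x m (splitRun y 1 λs)

split : List ℕ → List ℕ × List ℕ
split [] = [] , []
split (x ∷ λs) = splitRun x 1 λs

splitRun-run : ∀ {x λs} k m → All (_< x) λs →
               splitRun x k (replicate m x ++ λs) ≡ emit x (m + k) (split λs)
splitRun-run {λs = []} k zero [] = refl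
splitRun-run {x} {y ∷ λs} k zero (y<x ∷ _) with x ≟ y
... | yes refl = contradiction y<x (<-irrefl refl)
... | no _     = refl
splitRun-run {x} {λs} k (suc m) λs<x with x ≟ x
... | yes _  = trans (splitRun-run (suc k) m λs<x) (cong (λ j → emit x j (split λs)) (+-suc m k))
... | no x≢x = contradiction refl x≢x

Merge⇒split : ∀ {A B λs} → Merge A B λs → split λs ≡ (A , B)
Merge⇒split [] = refl
Merge⇒split (once {x} λs<x M) = trans (splitRun-run 1 0 λs<x) (cong (emit x 1) (Merge⇒split M))
Merge⇒split (twice {x} λs<x M) = trans (splitRun-run 1 1 λs<x) (cong (emit x 2) (Merge⇒split M))
Merge⇒split (thrice {x} λs<x M) = trans (splitRun-run 1 2 λs<x) (cong (emit x 3) (Merge⇒split M))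

InD4Coeff : ℕ → ℕ → ℕ → List ℕ → Set
InD4Coeff n a b λs = InD4 λs × e λs ≡ a × altSum λs ≡ b × oddSum λs ≡ n

InStrictPairCoeff : ℕ → ℕ → ℕ → List ℕ × List ℕ → Set
InStrictPairCoeff n a b (A , B) =
  (IsStrictPartition A × IsStrictPartition B) × length A ≡ a × altSum B ≡ b × sum A + oddSum B ≡ n

module _ {n a b : ℕ} {A B λs : List ℕ} (M : Merge A B λs) where

  Merge⇒InStrictPairCoeff : InD4Coeff n a b λs → InStrictPairCoeff n a b (A , B)
  Merge⇒InStrictPairCoeff (((_ , λs-pos) , _) , e≡a , alt≡b , odd≡n) =
    Product.zip _,_ _,_ (Merge⇒strict M) (Merge-All⁻ M λs-pos) ,
    trans (sym (Merge⇒e M)) e≡a ,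
    trans (sym (Merge⇒altSum M)) alt≡b ,
    trans (sym (Merge⇒oddSum M)) odd≡n

  Merge⇒InD4Coeff : InStrictPairCoeff n a b (A , B) → InD4Coeff n a b λs
  Merge⇒InD4Coeff (((_ , A-pos) , (_ , B-pos)) , ∣A∣≡a , alt≡b , odd≡n) =
    ((AllPairs⇒Linked (Merge⇒sorted M) , Merge-All⁺ M A-pos B-pos) , Merge⇒mult<4 M) ,
    trans (Merge⇒e M) ∣A∣≡a ,
    trans (Merge⇒altSum M) alt≡b ,
    trans (Merge⇒oddSum M) odd≡n

D4↔strictPairs : ∀ n a b → D4Coeff n a b ↔ Σ (List ℕ × List ℕ) (InStrictPairCoeff n a b)
D4↔strictPairs n a b =
  restrict-↔ (×-≡-irrelevant (×-irrelevant partition-irrelevant (All.irrelevant ≤-irrelevant)))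
             (×-≡-irrelevant (×-irrelevant strictPartition-irrelevant strictPartition-irrelevant))
             split (λ (A , B) → merge A B)
             to-coeff from-coeff merge∘split split∘merge
  where
  view : ∀ {λs} → InD4Coeff n a b λs → ∃₂ λ A B → Merge A B λs
  view ((λs-partition , bounded) , _) = InD4⇒Merge (partition-sorted λs-partition) bounded

  to-coeff : ∀ {λs} → InD4Coeff n a b λs → InStrictPairCoeff n a b (split λs)
  to-coeff p with view p
  ... | _ , _ , M = subst (InStrictPairCoeff n a b) (sym (Merge⇒split M)) (Merge⇒InStrictPairCoeff M p)

  from-coeff : ∀ {AB} → InStrictPairCoeff n a b AB → InD4Coeff n a b (merge (proj₁ AB) (proj₂ AB))
  from-coeff q@(((A-strict , _) , (B-strict , _)) , _) = Merge⇒InD4Coeff (merge-Merge A-strict B-strict) q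

  merge∘split : ∀ {λs} → InD4Coeff n a b λs → merge (proj₁ (split λs)) (proj₂ (split λs)) ≡ λs
  merge∘split p with view p
  ... | _ , _ , M = trans (cong (λ (A , B) → merge A B) (Merge⇒split M)) (Merge⇒merge M)

  split∘merge : ∀ {AB} → InStrictPairCoeff n a b AB → split (merge (proj₁ AB) (proj₂ AB)) ≡ AB
  split∘merge (((A-strict , _) , (B-strict , _)) , _) = Merge⇒split (merge-Merge A-strict B-strict)

-- Strict partitions and hooks
sum-replicate-1 : ∀ n → sum (replicate n 1) ≡ n
sum-replicate-1 zero = refl
sum-replicate-1 (suc n) = cong suc (sum-replicate-1 n)

sum-map-suc : ∀ ν → sum (map suc ν) ≡ length ν + sum ν
sum-map-suc [] = refl
sum-map-suc (x ∷ ν) =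
  cong suc (trans (cong (x +_) (sum-map-suc ν)) (x∙yz≈y∙xz x (length ν) (sum ν)))

AllPairs-replicate : ∀ {A : Set} {R : A → A → Set} {x} n → R x x → AllPairs R (replicate n x)
AllPairs-replicate zero _ = []
AllPairs-replicate (suc n) r = replicate⁺ n r ∷ AllPairs-replicate n r

altSum≤ : ∀ {D l} → AllPairs _≥_ l → All (_≤ D) l → altSum l ≤ D
altSum≤ {l = []} _ _ = z≤n
altSum≤ {l = x ∷ []} _ (x≤D ∷ []) = x≤D
altSum≤ {D} {x ∷ y ∷ r} ((y≤x ∷ _) ∷ (r≤y ∷ sorted)) (x≤D ∷ _) = begin
  (x ∸ y) + altSum r ≤⟨ +-monoʳ-≤ (x ∸ y) (altSum≤ sorted r≤y) ⟩
  (x ∸ y) + y       ≡⟨ m∸n+n≡m y≤x ⟩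
  x                 ≤⟨ x≤D ⟩
  D                 ∎
  where open ≤-Reasoning

altSum< : ∀ {D l} → AllPairs _≥_ l → All (_< D) l → 0 < D → altSum l < D
altSum< {l = []} _ _ 0<D = 0<D
altSum< {l = x ∷ l} sorted@(x≥l ∷ _) (x<D ∷ _) _ = ≤-<-trans (altSum≤ sorted (≤-refl ∷ x≥l)) x<D

addColumn : ℕ → List ℕ → List ℕ
addColumn l ν = map suc ν ++ replicate l 1

hook : ℕ → ℕ → List ℕ → List ℕ
hook arm leg ν = suc arm ∷ addColumn leg ν

hookPartition : List ℕ → List ℕ
hookPartition [] = []
hookPartition (c ∷ []) = replicate c 1
hookPartition (c ∷ d ∷ B) = hook (d ∸ length (hookPartition B)) (c ∸ suc d) (hookPartition B)

length-addColumn : ∀ l ν → length (addColumn l ν) ≡ length ν + l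
length-addColumn l ν = trans (length-++ (map suc ν)) (cong₂ _+_ (length-map suc ν) (length-replicate l))

length-hook : ∀ a l ν → length (hook a l ν) ≡ suc (length ν + l)
length-hook a l ν = cong suc (length-addColumn l ν)

sum-hook : ∀ a l ν → sum (hook a l ν) ≡ suc a + ((length ν + sum ν) + l)
sum-hook a l ν = cong (suc a +_)
  (trans (sum-++ (map suc ν) (replicate l 1)) (cong₂ _+_ (sum-map-suc ν) (sum-replicate-1 l)))

hook-positive : ∀ a l ν → All (0 <_) (hook a l ν)
hook-positive a l ν =
  s≤s z≤n ∷ ++⁺ (All.map⁺ (All.universal (λ _ → s≤s z≤n) ν)) (replicate⁺ l (s≤s z≤n))

hook-≤ : ∀ {a} l {ν} → All (_≤ a) ν → All (_≤ suc a) (hook a l ν)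
hook-≤ l ν≤a = ≤-refl ∷ ++⁺ (All.map⁺ (All.map s≤s ν≤a)) (replicate⁺ l (s≤s z≤n))

hook-sorted : ∀ {a} l {ν} → All (_≤ a) ν → AllPairs _≥_ ν → AllPairs _≥_ (hook a l ν)
hook-sorted l ν≤a sorted with hook-≤ l ν≤a
... | _ ∷ rest≤ =
  rest≤ ∷ AllPairs.++⁺ (AllPairs.map⁺ (AllPairs.map s≤s sorted)) (AllPairs-replicate l ≤-refl)
                       (All.map⁺ (All.universal (λ _ → replicate⁺ l (s≤s z≤n)) _))

hook-length : ∀ {c d k} → k ≤ d → d < c → suc (d ∸ k) + (k + (c ∸ suc d)) ≡ c
hook-length {c} {d} {k} k≤d d<c = begin
  suc (d ∸ k) + (k + (c ∸ suc d)) ≡⟨ cong suc (+-assoc (d ∸ k) k (c ∸ suc d)) ⟨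
  suc ((d ∸ k) + k + (c ∸ suc d)) ≡⟨ cong (λ m → suc m + (c ∸ suc d)) (m∸n+n≡m k≤d) ⟩
  suc d + (c ∸ suc d)             ≡⟨ m+[n∸m]≡n d<c ⟩
  c                               ∎
  where open ≡-Reasoning

length-hookPartition : ∀ {B} → IsStrictPartition B → length (hookPartition B) ≡ altSum B
length-hookPartition {[]} _ = refl
length-hookPartition {c ∷ []} _ = length-replicate c
length-hookPartition {c ∷ d ∷ r} (((d<c ∷ _) ∷ (_ ∷ r-strict)) , (_ ∷ _ ∷ r-pos)) = begin
  length (hook (d ∸ k) l ν) ≡⟨ length-hook (d ∸ k) l ν ⟩
  suc (k + l)               ≡⟨ cong suc (+-comm k l) ⟩
  suc l + k                 ≡⟨ cong₂ _+_ (sym (+-∸-assoc 1 d<c)) (length-hookPartition (r-strict , r-pos)) ⟩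
  (c ∸ d) + altSum r        ∎
  where
  open ≡-Reasoning
  ν = hookPartition r
  k = length ν
  l = c ∸ suc d

innerLength< : ∀ {c d r} → IsStrictPartition (c ∷ d ∷ r) → length (hookPartition r) < d
innerLength< {d = d} ((_ ∷ (r<d ∷ r-strict)) , (_ ∷ 0<d ∷ r-pos)) =
  subst (_< d) (sym (length-hookPartition (r-strict , r-pos)))
        (altSum< (strict⇒sorted r-strict) r<d 0<d)

sum-hookPartition : ∀ {B} → IsStrictPartition B → sum (hookPartition B) ≡ oddSum B
sum-hookPartition {[]} _ = refl
sum-hookPartition {c ∷ []} _ = sum-replicate-1 c
sum-hookPartition {c ∷ d ∷ r} strict@(((d<c ∷ _) ∷ (_ ∷ r-strict)) , (_ ∷ _ ∷ r-pos)) = begin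
  sum (hook (d ∸ k) l ν)                ≡⟨ sum-hook (d ∸ k) l ν ⟩
  suc (d ∸ k) + ((k + sum ν) + l)       ≡⟨ cong (λ s → suc (d ∸ k) + s) (xy∙z≈xz∙y k (sum ν) l) ⟩
  suc (d ∸ k) + ((k + l) + sum ν)       ≡⟨ +-assoc (suc (d ∸ k)) (k + l) (sum ν) ⟨
  suc (d ∸ k) + (k + l) + sum ν         ≡⟨ cong₂ _+_ (hook-length (<⇒≤ (innerLength< strict)) d<c)
                                                     (sum-hookPartition (r-strict , r-pos)) ⟩
  c + oddSum r                          ∎
  where
  open ≡-Reasoning
  ν = hookPartition r
  k = length ν
  l = c ∸ suc d

innerFits : ∀ {c d r} → IsStrictPartition (c ∷ d ∷ r) →
            All (_≤ d ∸ length (hookPartition r)) (hookPartition r)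

hookPartition-fits : ∀ {D B} → IsStrictPartition B → All (_< D) B →
                     All (λ x → x + length (hookPartition B) ≤ D) (hookPartition B)
hookPartition-fits {B = []} _ _ = []
hookPartition-fits {D} {c ∷ []} _ (c<D ∷ []) =
  replicate⁺ c (subst (λ k → suc k ≤ D) (sym (length-replicate c)) c<D)
hookPartition-fits {D} {c ∷ d ∷ r} B-strict@(((d<c ∷ _) ∷ _) , _) (c<D ∷ _) =
  All.map (λ x≤ → ≤-trans (+-monoˡ-≤ (length (hook a l ν)) x≤) first-row) (hook-≤ l ν≤a)
  where
  ν = hookPartition r
  k = length ν
  a = d ∸ k
  l = c ∸ suc d
  ν≤a = innerFits B-strict
  first-row : suc a + length (hook a l ν) ≤ D
  first-row = begin
    suc a + length (hook a l ν) ≡⟨ cong (suc a +_) (length-hook a l ν) ⟩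
    suc a + suc (k + l)         ≡⟨ +-suc (suc a) (k + l) ⟩
    suc (suc a + (k + l))       ≡⟨ cong suc (hook-length (<⇒≤ (innerLength< B-strict)) d<c) ⟩
    suc c                       ≤⟨ c<D ⟩
    D                           ∎
    where open ≤-Reasoning

innerFits ((_ ∷ (r<d ∷ r-strict)) , (_ ∷ _ ∷ r-pos)) =
  All.map (m+n≤o⇒m≤o∸n _) (hookPartition-fits (r-strict , r-pos) r<d)

hookPartition-sorted : ∀ {B} → IsStrictPartition B → AllPairs _≥_ (hookPartition B)
hookPartition-sorted {[]} _ = []
hookPartition-sorted {c ∷ []} _ = AllPairs-replicate c ≤-refl
hookPartition-sorted {c ∷ d ∷ r} B-strict@((_ ∷ (_ ∷ r-strict)) , (_ ∷ _ ∷ r-pos)) =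
  hook-sorted (c ∸ suc d) (innerFits B-strict) (hookPartition-sorted (r-strict , r-pos))

hookPartition-positive : ∀ B → All (0 <_) (hookPartition B)
hookPartition-positive [] = []
hookPartition-positive (c ∷ []) = replicate⁺ c (s≤s z≤n)
hookPartition-positive (c ∷ d ∷ r) = hook-positive _ (c ∸ suc d) (hookPartition r)

stripColumn : List ℕ → List ℕ
stripColumn [] = []
stripColumn (suc (suc x) ∷ ν) = suc x ∷ stripColumn ν
stripColumn (_ ∷ ν) = stripColumn ν

stripColumn⁺ : ∀ {P Q : ℕ → Set} → (∀ {x} → P (suc (suc x)) → Q (suc x)) →
               ∀ {ν} → All P ν → All Q (stripColumn ν)
stripColumn⁺ f {[]} [] = []
stripColumn⁺ f {zero ∷ ν} (_ ∷ ps) = stripColumn⁺ f ps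
stripColumn⁺ f {suc zero ∷ ν} (_ ∷ ps) = stripColumn⁺ f ps
stripColumn⁺ f {suc (suc x) ∷ ν} (p ∷ ps) = f p ∷ stripColumn⁺ f ps

stripColumn-sorted : ∀ {ν} → AllPairs _≥_ ν → AllPairs _≥_ (stripColumn ν)
stripColumn-sorted {[]} [] = []
stripColumn-sorted {zero ∷ ν} (_ ∷ sorted) = stripColumn-sorted sorted
stripColumn-sorted {suc zero ∷ ν} (_ ∷ sorted) = stripColumn-sorted sorted
stripColumn-sorted {suc (suc x) ∷ ν} (ν≤x ∷ sorted) =
  stripColumn⁺ ≤-pred ν≤x ∷ stripColumn-sorted sorted

stripColumn-positive : ∀ ν → All (0 <_) (stripColumn ν)
stripColumn-positive [] = []
stripColumn-positive (zero ∷ ν) = stripColumn-positive ν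
stripColumn-positive (suc zero ∷ ν) = stripColumn-positive ν
stripColumn-positive (suc (suc x) ∷ ν) = s≤s z≤n ∷ stripColumn-positive ν

length-stripColumn : ∀ ν → length (stripColumn ν) ≤ length ν
length-stripColumn [] = z≤n
length-stripColumn (zero ∷ ν) = m≤n⇒m≤1+n (length-stripColumn ν)
length-stripColumn (suc zero ∷ ν) = m≤n⇒m≤1+n (length-stripColumn ν)
length-stripColumn (suc (suc x) ∷ ν) = s≤s (length-stripColumn ν)

stripColumn-ones : ∀ {ν} → All (_≤ 1) ν → stripColumn ν ≡ []
stripColumn-ones {[]} [] = refl
stripColumn-ones {zero ∷ ν} (_ ∷ ν≤1) = stripColumn-ones ν≤1
stripColumn-ones {suc zero ∷ ν} (_ ∷ ν≤1) = stripColumn-ones ν≤1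
stripColumn-ones {suc (suc x) ∷ ν} (s≤s () ∷ _)

replicate-ones : ∀ {ν} → All (_≤ 1) ν → All (0 <_) ν → replicate (length ν) 1 ≡ ν
replicate-ones {[]} [] [] = refl
replicate-ones {suc zero ∷ ν} (_ ∷ ν≤1) (_ ∷ ν-pos) = cong (1 ∷_) (replicate-ones ν≤1 ν-pos)
replicate-ones {suc (suc x) ∷ ν} (s≤s () ∷ _) _

stripColumn-addColumn : ∀ l {ν} → All (0 <_) ν → stripColumn (addColumn l ν) ≡ ν
stripColumn-addColumn l {[]} [] = stripColumn-ones (replicate⁺ l ≤-refl)
stripColumn-addColumn l {suc x ∷ ν} (_ ∷ ν-pos) = cong (suc x ∷_) (stripColumn-addColumn l ν-pos)

addColumn-stripColumn : ∀ {ν} → AllPairs _≥_ ν → All (0 <_) ν →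
                        addColumn (length ν ∸ length (stripColumn ν)) (stripColumn ν) ≡ ν
addColumn-stripColumn {[]} [] [] = refl
addColumn-stripColumn {suc zero ∷ ν} (ν≤1 ∷ _) (_ ∷ ν-pos) rewrite stripColumn-ones ν≤1 =
  cong (1 ∷_) (replicate-ones ν≤1 ν-pos)
addColumn-stripColumn {suc (suc x) ∷ ν} (_ ∷ sorted) (_ ∷ ν-pos) =
  cong (suc (suc x) ∷_) (addColumn-stripColumn sorted ν-pos)

-- Recursion on fuel, which bounds the number of hooks peeled off; `length ν` always suffices.
hookCode′ : ℕ → List ℕ → List ℕ
hookCode′ _ [] = []
hookCode′ (suc fuel) (1 ∷ ν) = suc (length ν) ∷ []
hookCode′ (suc fuel) (suc (suc a) ∷ ν) =
  suc (suc a) + length ν ∷ suc a + length (stripColumn ν) ∷ hookCode′ fuel (stripColumn ν)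
hookCode′ _ _ = []

hookCode : List ℕ → List ℕ
hookCode ν = hookCode′ (length ν) ν

hookCode′-hook : ∀ {fuel a} l {ν} → 0 < a → All (0 <_) ν →
                 hookCode′ (suc fuel) (hook a l ν) ≡
                 suc a + (length ν + l) ∷ a + length ν ∷ hookCode′ fuel ν
hookCode′-hook {a = suc a} l {ν} _ ν-pos
  rewrite stripColumn-addColumn l ν-pos | length-addColumn l ν = refl

hookCode′-hookPartition : ∀ {fuel B} → IsStrictPartition B → length (hookPartition B) ≤ fuel →
                          hookCode′ fuel (hookPartition B) ≡ B
hookCode′-hookPartition {B = []} _ _ = refl
hookCode′-hookPartition {B = zero ∷ []} (_ , () ∷ _) _
hookCode′-hookPartition {zero} {suc c ∷ []} _ ()
hookCode′-hookPartition {suc fuel} {suc c ∷ []} _ _ = cong (λ n → suc n ∷ []) (length-replicate c)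
hookCode′-hookPartition {zero} {c ∷ d ∷ r} _ ()
hookCode′-hookPartition {suc fuel} {c ∷ d ∷ r}
                        B-strict@(((d<c ∷ _) ∷ (_ ∷ r-strict)) , (_ ∷ _ ∷ r-pos)) (s≤s ℓ≤fuel) = begin
    hookCode′ (suc fuel) (hook (d ∸ k) l ν)
  ≡⟨ hookCode′-hook l (m<n⇒0<n∸m k<d) (hookPartition-positive r) ⟩
    suc (d ∸ k) + (k + l) ∷ (d ∸ k) + k ∷ hookCode′ fuel ν
  ≡⟨ cong₂ _∷_ (hook-length (<⇒≤ k<d) d<c)
               (cong₂ _∷_ (m∸n+n≡m (<⇒≤ k<d)) (hookCode′-hookPartition (r-strict , r-pos) k≤fuel)) ⟩
    c ∷ d ∷ r
  ∎
  where
  open ≡-Reasoning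
  ν = hookPartition r
  k = length ν
  l = c ∸ suc d
  k<d = innerLength< B-strict
  k≤fuel : k ≤ fuel
  k≤fuel = ≤-trans (m≤m+n k l) (subst (_≤ fuel) (length-addColumn l ν) ℓ≤fuel)

hookPartition-hookCode′ : ∀ {fuel ν} → AllPairs _≥_ ν → All (0 <_) ν → length ν ≤ fuel →
                          hookPartition (hookCode′ fuel ν) ≡ ν
hookPartition-hookCode′ {ν = []} _ _ _ = refl
hookPartition-hookCode′ {ν = zero ∷ _} _ (() ∷ _) _
hookPartition-hookCode′ {zero} {_ ∷ _} _ _ ()
hookPartition-hookCode′ {suc fuel} {suc zero ∷ ν} (ν≤1 ∷ _) (_ ∷ ν-pos) _ =
  cong (1 ∷_) (replicate-ones ν≤1 ν-pos)
hookPartition-hookCode′ {suc fuel} {suc (suc a) ∷ ν} (_ ∷ sorted) (_ ∷ ν-pos) (s≤s ℓ≤fuel) = begin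
    hook (suc a + length s ∸ length ρ) leg ρ
  ≡⟨ cong (λ ρ → hook (suc a + length s ∸ length ρ) leg ρ) inner ⟩
    hook (suc a + length s ∸ length s) leg s
  ≡⟨ cong₂ (λ arm leg → hook arm leg s) (m+n∸n≡m (suc a) (length s))
                                         ([m+n]∸[m+o]≡n∸o (suc a) (length ν) (length s)) ⟩
    hook (suc a) (length ν ∸ length s) s
  ≡⟨ cong (suc (suc a) ∷_) (addColumn-stripColumn sorted ν-pos) ⟩
    suc (suc a) ∷ ν
  ∎
  where
  open ≡-Reasoning
  s = stripColumn ν
  leg = suc a + length ν ∸ (suc a + length s)
  ρ = hookPartition (hookCode′ fuel s)
  inner : ρ ≡ s
  inner = hookPartition-hookCode′ (stripColumn-sorted sorted) (stripColumn-positive ν)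
                                  (≤-trans (length-stripColumn ν) ℓ≤fuel)

hookCode′-bounded : ∀ {fuel M ν} → AllPairs _≥_ ν → All (_≤ M) ν →
                    AllPairs _>_ (hookCode′ fuel ν) × All (_< M + length ν) (hookCode′ fuel ν)
hookCode′-bounded {ν = []} _ _ = [] , []
hookCode′-bounded {zero} {ν = _ ∷ _} _ _ = [] , []
hookCode′-bounded {suc fuel} {ν = zero ∷ _} _ _ = [] , []
hookCode′-bounded {suc fuel} {M} {suc zero ∷ ν} _ (1≤M ∷ _) =
  ([] ∷ []) , (+-monoˡ-≤ (suc (length ν)) 1≤M ∷ [])
hookCode′-bounded {suc fuel} {M} {suc (suc a) ∷ ν} (ν≤ ∷ sorted) (a+2≤M ∷ _) =
  ((d<c ∷ All.map (λ x<d → <-trans x<d d<c) r<d) ∷ (r<d ∷ r-strict)) ,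
  (c<M ∷ <-trans d<c c<M ∷ All.map (λ x<d → <-trans x<d (<-trans d<c c<M)) r<d)
  where
  s = stripColumn ν
  rest = hookCode′-bounded {fuel} {suc a} {s} (stripColumn-sorted sorted) (stripColumn⁺ ≤-pred ν≤)
  r-strict = proj₁ rest
  r<d = proj₂ rest
  d<c : suc a + length s < suc (suc a) + length ν
  d<c = s≤s (+-monoʳ-≤ (suc a) (length-stripColumn ν))
  c<M : suc (suc a) + length ν < M + suc (length ν)
  c<M = ≤-trans (s≤s (+-monoˡ-≤ (length ν) a+2≤M)) (≤-reflexive (sym (+-suc M (length ν))))

hookCode′-positive : ∀ fuel ν → All (0 <_) (hookCode′ fuel ν)
hookCode′-positive _ [] = []
hookCode′-positive zero (_ ∷ _) = []
hookCode′-positive (suc fuel) (zero ∷ ν) = []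
hookCode′-positive (suc fuel) (suc zero ∷ ν) = s≤s z≤n ∷ []
hookCode′-positive (suc fuel) (suc (suc a) ∷ ν) =
  s≤s z≤n ∷ s≤s z≤n ∷ hookCode′-positive fuel (stripColumn ν)

hookCode-strict : ∀ {ν} → AllPairs _≥_ ν → IsStrictPartition (hookCode ν)
hookCode-strict {[]} _ = [] , []
hookCode-strict {x ∷ ν} sorted@(x≥ν ∷ _) =
  proj₁ (hookCode′-bounded sorted (≤-refl ∷ x≥ν)) , hookCode′-positive _ _

InMixedCoeff : ℕ → ℕ → ℕ → List ℕ × List ℕ → Set
InMixedCoeff n a b (A , ν) =
  (IsStrictPartition A × IsPartition ν) × length A ≡ a × length ν ≡ b × sum A + sum ν ≡ n

strictPairs↔mixedPairs : ∀ n a b →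
                         Σ (List ℕ × List ℕ) (InStrictPairCoeff n a b) ↔ Σ (List ℕ × List ℕ) (InMixedCoeff n a b)
strictPairs↔mixedPairs n a b =
  restrict-↔ (×-≡-irrelevant (×-irrelevant strictPartition-irrelevant strictPartition-irrelevant))
             (×-≡-irrelevant (×-irrelevant strictPartition-irrelevant partition-irrelevant))
             (λ (A , B) → A , hookPartition B) (λ (A , ν) → A , hookCode ν)
             to-coeff from-coeff
             (λ {(A , B)} ((_ , B-strict) , _) → cong (A ,_) (hookCode′-hookPartition B-strict ≤-refl))
             (λ {(A , ν)} ((_ , ν-partition) , _) →
                cong (A ,_) (hookPartition-hookCode′ (partition-sorted ν-partition) (proj₂ ν-partition) ≤-refl))
  where
  to-coeff : ∀ {p} → InStrictPairCoeff n a b p → InMixedCoeff n a b (proj₁ p , hookPartition (proj₂ p))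
  to-coeff {A , B} ((A-strict , B-strict) , ∣A∣≡a , altB≡b , ΣAB≡n) =
    (A-strict , (AllPairs⇒Linked (hookPartition-sorted B-strict) , hookPartition-positive B)) ,
    ∣A∣≡a ,
    trans (length-hookPartition B-strict) altB≡b ,
    trans (cong (sum A +_) (sum-hookPartition B-strict)) ΣAB≡n
  from-coeff : ∀ {p} → InMixedCoeff n a b p → InStrictPairCoeff n a b (proj₁ p , hookCode (proj₂ p))
  from-coeff {A , ν} ((A-strict , ν-partition) , ∣A∣≡a , ∣ν∣≡b , ΣAν≡n) =
    (A-strict , B-strict) ,
    ∣A∣≡a ,
    trans (sym (length-hookPartition B-strict)) (trans (cong length ν≡) ∣ν∣≡b) ,
    trans (cong (sum A +_) (trans (sym (sum-hookPartition B-strict)) (cong sum ν≡))) ΣAν≡n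
    where
    B-strict = hookCode-strict (partition-sorted ν-partition)
    ν≡ = hookPartition-hookCode′ (partition-sorted ν-partition) (proj₂ ν-partition) ≤-refl

-- Overpartitions
OvStep⇒≥ : ∀ {p y b} → OvStep p (y , b) → y ≤ proj₁ p
OvStep⇒≥ {b = true}  = <⇒≤
OvStep⇒≥ {b = false} = id

OvStep-trans : Transitive OvStep
OvStep-trans {k = z , true}  x→y y→z = <-≤-trans y→z (OvStep⇒≥ x→y)
OvStep-trans {k = z , false} x→y y→z = ≤-trans y→z (OvStep⇒≥ x→y)

OvStep-irrelevant : ∀ {p q} → Irrelevant (OvStep p q)
OvStep-irrelevant {q = _ , true}  = ≤-irrelevant
OvStep-irrelevant {q = _ , false} = ≤-irrelevant

overlinedParts : List (ℕ × Bool) → List ℕ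
overlinedParts [] = []
overlinedParts ((x , true) ∷ μ) = x ∷ overlinedParts μ
overlinedParts ((x , false) ∷ μ) = overlinedParts μ

plainParts : List (ℕ × Bool) → List ℕ
plainParts [] = []
plainParts ((x , true) ∷ μ) = plainParts μ
plainParts ((x , false) ∷ μ) = x ∷ plainParts μ

module _ {R : ℕ × Bool → Set} {P : ℕ → Set} where

  overlinedParts⁺ : (∀ {x} → R (x , true) → P x) → ∀ {μ} → All R μ → All P (overlinedParts μ)
  overlinedParts⁺ f {[]} [] = []
  overlinedParts⁺ f {(x , true) ∷ μ} (r ∷ rs) = f r ∷ overlinedParts⁺ f rs
  overlinedParts⁺ f {(x , false) ∷ μ} (r ∷ rs) = overlinedParts⁺ f rs

  plainParts⁺ : (∀ {x} → R (x , false) → P x) → ∀ {μ} → All R μ → All P (plainParts μ)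
  plainParts⁺ f {[]} [] = []
  plainParts⁺ f {(x , true) ∷ μ} (r ∷ rs) = plainParts⁺ f rs
  plainParts⁺ f {(x , false) ∷ μ} (r ∷ rs) = f r ∷ plainParts⁺ f rs

overlined-length : ∀ μ → overlined μ ≡ length (overlinedParts μ)
overlined-length [] = refl
overlined-length ((x , true) ∷ μ) = cong suc (overlined-length μ)
overlined-length ((x , false) ∷ μ) = overlined-length μ

length-parts : ∀ μ → length μ ≡ length (overlinedParts μ) + length (plainParts μ)
length-parts [] = refl
length-parts ((x , true) ∷ μ) = cong suc (length-parts μ)
length-parts ((x , false) ∷ μ) = trans (cong suc (length-parts μ)) (sym (+-suc _ _))

plain-length : ∀ μ → length μ ∸ overlined μ ≡ length (plainParts μ)
plain-length μ =
  trans (cong₂ _∸_ (length-parts μ) (overlined-length μ)) (m+n∸m≡n (length (overlinedParts μ)) _)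

size-parts : ∀ μ → size μ ≡ sum (overlinedParts μ) + sum (plainParts μ)
size-parts [] = refl
size-parts ((x , true) ∷ μ) = trans (cong (x +_) (size-parts μ)) (sym (+-assoc x _ _))
size-parts ((x , false) ∷ μ) =
  trans (cong (x +_) (size-parts μ)) (x∙yz≈y∙xz x (sum (overlinedParts μ)) (sum (plainParts μ)))

parts-sorted : ∀ {μ} → AllPairs OvStep μ →
               AllPairs _>_ (overlinedParts μ) × AllPairs _≥_ (plainParts μ)
parts-sorted {[]} [] = [] , []
parts-sorted {(x , true) ∷ μ} (x→μ ∷ sorted) = Product.map₁ (overlinedParts⁺ id x→μ ∷_) (parts-sorted sorted)
parts-sorted {(x , false) ∷ μ} (x→μ ∷ sorted) = Product.map₂ (plainParts⁺ id x→μ ∷_) (parts-sorted sorted)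

interleave : List ℕ → List ℕ → List (ℕ × Bool)
interleave [] ν = map (_, false) ν
interleave (a ∷ A) [] = (a , true) ∷ interleave A []
interleave aA@(a ∷ A) xν@(x ∷ ν) =
  if x ≤ᵇ a then (a , true) ∷ interleave A xν else (x , false) ∷ interleave aA ν

module _ {P Q : ℕ → Set} {R : ℕ × Bool → Set}
         (P⇒R : ∀ {x} → P x → R (x , true)) (Q⇒R : ∀ {x} → Q x → R (x , false)) where

  interleave⁺ : ∀ {A ν} → All P A → All Q ν → All R (interleave A ν)
  interleave⁺ {[]} [] [] = []
  interleave⁺ {[]} [] (q ∷ qs) = Q⇒R q ∷ interleave⁺ [] qs
  interleave⁺ {a ∷ A} {[]} (p ∷ ps) [] = P⇒R p ∷ interleave⁺ ps []
  interleave⁺ {a ∷ A} {x ∷ ν} (p ∷ ps) (q ∷ qs)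
    with x ≤ᵇ a | interleave⁺ ps (q ∷ qs) | interleave⁺ (p ∷ ps) qs
  ... | true  | rest | _    = P⇒R p ∷ rest
  ... | false | _    | rest = Q⇒R q ∷ rest

interleave-below : ∀ {x b A ν} → All (_< x) A → All (_≤ x) ν →
                   All (OvStep (x , b)) (interleave A ν)
interleave-below = interleave⁺ id id

overlinedParts-interleave : ∀ A ν → overlinedParts (interleave A ν) ≡ A
overlinedParts-interleave [] [] = refl
overlinedParts-interleave [] (x ∷ ν) = overlinedParts-interleave [] ν
overlinedParts-interleave (a ∷ A) [] = cong (a ∷_) (overlinedParts-interleave A [])
overlinedParts-interleave (a ∷ A) (x ∷ ν)
  with x ≤ᵇ a | overlinedParts-interleave A (x ∷ ν) | overlinedParts-interleave (a ∷ A) ν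
... | true  | eq | _  = cong (a ∷_) eq
... | false | _  | eq = eq

plainParts-interleave : ∀ A ν → plainParts (interleave A ν) ≡ ν
plainParts-interleave [] [] = refl
plainParts-interleave [] (x ∷ ν) = cong (x ∷_) (plainParts-interleave [] ν)
plainParts-interleave (a ∷ A) [] = plainParts-interleave A []
plainParts-interleave (a ∷ A) (x ∷ ν)
  with x ≤ᵇ a | plainParts-interleave A (x ∷ ν) | plainParts-interleave (a ∷ A) ν
... | true  | eq | _  = eq
... | false | _  | eq = cong (x ∷_) eq

interleave-overlined : ∀ {a} A {ν} → All (_≤ a) ν →
                       interleave (a ∷ A) ν ≡ (a , true) ∷ interleave A ν
interleave-overlined A {[]} [] = refl
interleave-overlined {a} A {x ∷ ν} (x≤a ∷ _) with x ≤ᵇ a | ≤ᵇ-reflects-≤ x a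
... | true  | _       = refl
... | false | ofⁿ x≰a = contradiction x≤a x≰a

interleave-plain : ∀ {x} A {ν} → All (_< x) A →
                   interleave A (x ∷ ν) ≡ (x , false) ∷ interleave A ν
interleave-plain [] [] = refl
interleave-plain {x} (a ∷ A) (a<x ∷ _) with x ≤ᵇ a | ≤ᵇ-reflects-≤ x a
... | true  | ofʸ x≤a = contradiction x≤a (<⇒≱ a<x)
... | false | _       = refl

interleave-split : ∀ {μ} → AllPairs OvStep μ → interleave (overlinedParts μ) (plainParts μ) ≡ μ
interleave-split {[]} [] = refl
interleave-split {(x , true) ∷ μ} (x→μ ∷ sorted) =
  trans (interleave-overlined _ (plainParts⁺ id x→μ)) (cong ((x , true) ∷_) (interleave-split sorted))
interleave-split {(x , false) ∷ μ} (x→μ ∷ sorted) =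
  trans (interleave-plain _ (overlinedParts⁺ id x→μ)) (cong ((x , false) ∷_) (interleave-split sorted))

interleave-sorted : ∀ {A ν} → AllPairs _>_ A → AllPairs _≥_ ν → AllPairs OvStep (interleave A ν)
interleave-sorted {[]} {[]} [] [] = []
interleave-sorted {[]} {x ∷ ν} [] (x≥ν ∷ ν-sorted) =
  interleave-below [] x≥ν ∷ interleave-sorted [] ν-sorted
interleave-sorted {a ∷ A} {[]} (a>A ∷ A-sorted) [] =
  interleave-below a>A [] ∷ interleave-sorted A-sorted []
interleave-sorted {a ∷ A} {x ∷ ν} (a>A ∷ A-sorted) (x≥ν ∷ ν-sorted)
  with x ≤ᵇ a | ≤ᵇ-reflects-≤ x a
     | interleave-sorted A-sorted (x≥ν ∷ ν-sorted) | interleave-sorted (a>A ∷ A-sorted) ν-sorted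
... | true | ofʸ x≤a | rest | _ =
  interleave-below a>A (x≤a ∷ All.map (λ y≤x → ≤-trans y≤x x≤a) x≥ν) ∷ rest
... | false | ofⁿ x≰a | _ | rest =
  interleave-below (a<x ∷ All.map (λ y<a → <-trans y<a a<x) a>A) x≥ν ∷ rest
  where a<x = ≰⇒> x≰a

InOPCoeff : ℕ → ℕ → ℕ → List (ℕ × Bool) → Set
InOPCoeff n a b μ = IsOverpartition μ × overlined μ ≡ a × length μ ∸ overlined μ ≡ b × size μ ≡ n

mixedPairs↔overpartitions : ∀ n a b → Σ (List ℕ × List ℕ) (InMixedCoeff n a b) ↔ OPCoeff n a b
mixedPairs↔overpartitions n a b =
  restrict-↔ (×-≡-irrelevant (×-irrelevant strictPartition-irrelevant partition-irrelevant))
             (×-≡-irrelevant (×-irrelevant (Linked.irrelevant OvStep-irrelevant)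
                                           (All.irrelevant ≤-irrelevant)))
             (λ (A , ν) → interleave A ν) (λ μ → overlinedParts μ , plainParts μ)
             to-coeff from-coeff
             (λ {(A , ν)} _ → cong₂ _,_ (overlinedParts-interleave A ν) (plainParts-interleave A ν))
             (λ ((μ-linked , _) , _) → interleave-split (Linked⇒AllPairs OvStep-trans μ-linked))
  where
  to-coeff : ∀ {p} → InMixedCoeff n a b p → InOPCoeff n a b (interleave (proj₁ p) (proj₂ p))
  to-coeff {A , ν} (((A-strict , A-pos) , ν-partition) , ∣A∣≡a , ∣ν∣≡b , ΣAν≡n) =
    (AllPairs⇒Linked (interleave-sorted A-strict (partition-sorted ν-partition)) ,
     interleave⁺ id id A-pos (proj₂ ν-partition)) ,
    trans (overlined-length μ) (trans (cong length overlined≡A) ∣A∣≡a) ,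
    trans (plain-length μ) (trans (cong length plain≡ν) ∣ν∣≡b) ,
    trans (size-parts μ) (trans (cong₂ _+_ (cong sum overlined≡A) (cong sum plain≡ν)) ΣAν≡n)
    where
    μ = interleave A ν
    overlined≡A = overlinedParts-interleave A ν
    plain≡ν = plainParts-interleave A ν
  from-coeff : ∀ {μ} → InOPCoeff n a b μ → InMixedCoeff n a b (overlinedParts μ , plainParts μ)
  from-coeff {μ} ((μ-linked , μ-pos) , o≡a , ℓ∸o≡b , ∣μ∣≡n) =
    ((proj₁ sorted , overlinedParts⁺ id μ-pos) , (AllPairs⇒Linked (proj₂ sorted) , plainParts⁺ id μ-pos)) ,
    trans (sym (overlined-length μ)) o≡a ,
    trans (sym (plain-length μ)) ℓ∸o≡b ,
    trans (sym (size-parts μ)) ∣μ∣≡n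
    where sorted = parts-sorted (Linked⇒AllPairs OvStep-trans μ-linked)

corollary1 : (n a b : ℕ) → D4Coeff n a b ↔ OPCoeff n a b
corollary1 n a b =
  ↔-trans (D4↔strictPairs n a b)
          (↔-trans (strictPairs↔mixedPairs n a b) (mixedPairs↔overpartitions n a b))
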